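{- Let $n\ge1$, let $G=\mathbb{Z}/2\mathbb{Z}*\mathrm{Sym}(n+1)$ act on $\mathbb{D}_n$ by $\alpha*\beta$, and let $x\in\mathbb{D}_n$ with stabilizer $G_x=\{g\in G:(\alpha*\beta)(g,x)=x\}$. Then $G_x$ is a normal subgroup of $G$ and the morphism $\varphi$ induces a group isomorphism $\overline{\varphi}:G/G_x\to(\mathbb{Z}/2\mathbb{Z})^{n+1}\rtimes_Q\mathrm{Sym}(n+1)$, $gG_x\mapsto\varphi(g)$; in particular $G/G_x\cong(\mathbb{Z}/2\mathbb{Z})^{n+1}\rtimes_Q\mathrm{Sym}(n+1)$. Furthermore, for all $g\in G$, $(\alpha_n\times\varsigma_n)(\varphi(g),x)=(\alpha*\beta)(g,x)$.
   Context: $\mathbb{N}^*=\mathbb{N}\setminus\{0\}$. $\mathrm{Sym}(n+1)$ is the group of bijections of $\{1,\dots,n+1\}$ with product $\sigma\cdot\rho:=\rho\circ\sigma$; $(n+1\ n+1)=\mathrm{id}$. Arithmetic in $\mathbb{Z}/2\mathbb{Z}$; $\delta_{i,j}$ Kronecker delta; vectors are columns; $\mathbf{1}=(1,\dots,1)$. $Q(\sigma)_{i,j}=\delta_{(n+1\ \sigma(n+1))(\sigma(i)),\,j}+\delta_{\sigma(n+1),j}(1+\delta_{n+1,\sigma(i)})(1+\delta_{\sigma(n+1),n+1})$. $R(\sigma,v)=d^\sigma+Q(\sigma)v$ with $d^\sigma_j=(1+\delta_{n+1,\sigma(j)})(1+\delta_{n+1,\sigma(n+1)})$; $P_{\mathbb{N}^*}(\sigma)(k_1,\dots,k_{n+1})=(k_{\sigma(1)},\dots,k_{\sigma(n+1)})$.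 $\mathbb{D}_n=\mathrm{Sym}(n+1)\times(\mathbb{N}^*)^{n+1}\times(\mathbb{Z}/2\mathbb{Z})^{n+1}\times\mathbb{Z}/2\mathbb{Z}$; $\alpha''_n(\sigma,(\sigma',k,v,s))=(\sigma\cdot\sigma',P_{\mathbb{N}^*}(\sigma)(k),R(\sigma,v),s)$ (an action of $\mathrm{Sym}(n+1)$); $\varsigma(b,(\sigma',k,v,s))=(\sigma',k,b+v,s)$; the boolean-negation action of $\mathbb{Z}/2\mathbb{Z}$ is $\beta(s,y)=\varsigma(s\mathbf{1},y)$. $\alpha*\beta$ is the action of the free product $G=\mathbb{Z}/2\mathbb{Z}*\mathrm{Sym}(n+1)$ on $\mathbb{D}_n$ restricting to $\beta$ on $\mathbb{Z}/2\mathbb{Z}$ and to $\alpha''_n$ on $\mathrm{Sym}(n+1)$, so $(\alpha*\beta)(s_1\sigma_1\cdots s_l\sigma_l,y)=\beta(s_1,\alpha''_n(\sigma_1,\dots\beta(s_l,\alpha''_n(\sigma_l,y))))$. The semidirect product $(\mathbb{Z}/2\mathbb{Z})^{n+1}\rtimes_Q\mathrm{Sym}(n+1)$ has product $(b,\sigma)(b',\sigma')=(b+Q(\sigma)b',\sigma\cdot\sigma')$ and acts on $\mathbb{D}_n$ by $(\alpha_n\times\varsigma_n)((b,\sigma),y)=\varsigma(b,\alpha''_n(\sigma,y))$. $\varphi:G\to(\mathbb{Z}/2\mathbb{Z})^{n+1}\rtimes_Q\mathrm{Sym}(n+1)$ is the group morphism with $\varphi(s_1\sigma_1\cdots s_l\sigma_l)=\big(\sum_{i=1}^lQ(\sigma_1\cdots\sigma_{i-1})(s_i\mathbf{1}),\sigma_1\cdots\sigma_l\big)$.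 -}

module Defs where

open import Data.Nat using (ℕ; zero; suc; NonZero)
open import Data.Bool using (Bool; true; false; not; _∧_; _xor_)
open import Data.Fin using (Fin; fromℕ; _≟_)
open import Data.Fin.Permutation as Perm using (Permutation′; _⟨$⟩ʳ_; _∘ₚ_; transpose; flip)
open import Data.Vec using (Vec; []; _∷_; lookup; tabulate; replicate; zipWith)
open import Data.List using (List; []; _∷_; _++_; [_])
open import Data.Product using (Σ; _×_; _,_; proj₁; proj₂)
open import Relation.Nullary using (does)
open import Relation.Binary.PropositionalEquality using (_≡_)
open import Algebra.Bundles.Raw using (RawGroup)
open import Level using (0ℓ)

-- Basic notation.  n is the paper's n; the ground set is Fin (suc n),
-- the element "n+1" is  top n = fromℕ n.

ℕ* : Set
ℕ* = Σ ℕ NonZero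

-- ℤ/2ℤ is Bool with  + = xor,  · = ∧,  0 = false, 1 = true.
Z2 : Set
Z2 = Bool

top : (n : ℕ) → Fin (suc n)
top n = fromℕ n

-- Sym(n+1) : permutations of Fin (suc n), product  σ · ρ := ρ ∘ σ
Sym : ℕ → Set
Sym n = Permutation′ (suc n)

infixl 7 _·_
_·_ : ∀ {n} → Sym n → Sym n → Sym n
σ · ρ = σ ∘ₚ ρ        -- (σ ∘ₚ ρ) ⟨$⟩ʳ i = ρ ⟨$⟩ʳ (σ ⟨$⟩ʳ i)

idP : ∀ {n} → Sym n
idP = Perm.id

invP : ∀ {n} → Sym n → Sym n
invP = flip

_≈P_ : ∀ {n} → Sym n → Sym n → Set
_≈P_ = Perm._≈_

δ : ∀ {m} → Fin m → Fin m → Z2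
δ i j = does (i ≟ j)

Σ₂ : ∀ {m} → (Fin m → Z2) → Z2
Σ₂ {zero}  f = false
Σ₂ {suc m} f = f Fin.zero xor Σ₂ {m} (λ i → f (Fin.suc i))
  where import Data.Fin as Fin

V2 : ℕ → Set
V2 n = Vec Z2 (suc n)

_+V_ : ∀ {n} → V2 n → V2 n → V2 n
_+V_ = zipWith _xor_

0V : ∀ {n} → V2 n
0V = replicate _ false

_·𝟏 : ∀ {n} → Z2 → V2 n
s ·𝟏 = replicate _ s

Mat : ℕ → Set
Mat n = Fin (suc n) → Fin (suc n) → Z2

_*M_ : ∀ {n} → Mat n → V2 n → V2 n
M *M v = tabulate (λ i → Σ₂ (λ j → M i j ∧ lookup v j))

Q : ∀ {n} → Sym n → Mat n
Q {n} σ i j =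
  δ (transpose (top n) (σ ⟨$⟩ʳ top n) ⟨$⟩ʳ (σ ⟨$⟩ʳ i)) j
  xor (δ (σ ⟨$⟩ʳ top n) j
       ∧ (not (δ (top n) (σ ⟨$⟩ʳ i)) ∧ not (δ (σ ⟨$⟩ʳ top n) (top n))))

d : ∀ {n} → Sym n → V2 n
d {n} σ = tabulate (λ j → not (δ (top n) (σ ⟨$⟩ʳ j)) ∧ not (δ (top n) (σ ⟨$⟩ʳ top n)))

R : ∀ {n} → Sym n → V2 n → V2 n
R σ v = d σ +V (Q σ *M v)

P : ∀ {n} → Sym n → Vec ℕ* (suc n) → Vec ℕ* (suc n)
P σ k = tabulate (λ i → lookup k (σ ⟨$⟩ʳ i))

record 𝔻 (n : ℕ) : Set where
  constructor ⟨_,_,_,_⟩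
  field
    perm : Sym n
    kk   : Vec ℕ* (suc n)
    vv   : V2 n
    ss   : Z2

_≈𝔻_ : ∀ {n} → 𝔻 n → 𝔻 n → Set
⟨ σ , k , v , s ⟩ ≈𝔻 ⟨ σ' , k' , v' , s' ⟩ =
  (σ ≈P σ') × (k ≡ k') × (v ≡ v') × (s ≡ s')

α'' : ∀ {n} → Sym n → 𝔻 n → 𝔻 n
α'' σ ⟨ σ' , k , v , s ⟩ = ⟨ σ · σ' , P σ k , R σ v , s ⟩

ς : ∀ {n} → V2 n → 𝔻 n → 𝔻 n
ς b ⟨ σ' , k , v , s ⟩ = ⟨ σ' , k , b +V v , s ⟩

β : ∀ {n} → Z2 → 𝔻 n → 𝔻 n
β s y = ς (s ·𝟏) y

-- The free product G = ℤ/2ℤ * Sym(n+1), elements written as words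
-- s₁σ₁ ⋯ s_lσ_l, i.e. lists of pairs (sᵢ , σᵢ).

Word : ℕ → Set
Word n = List (Z2 × Sym n)

invW : ∀ {n} → Word n → Word n
invW []             = []
invW ((s , σ) ∷ w)  = invW w ++ ((false , invP σ) ∷ (s , idP) ∷ [])

act : ∀ {n} → Word n → 𝔻 n → 𝔻 n
act []            y = y
act ((s , σ) ∷ w) y = β s (α'' σ (act w y))

Stab : ∀ {n} → 𝔻 n → Word n → Set
Stab x g = act g x ≈𝔻 x

record IsNormalSubgroup {n} (N : Word n → Set) : Set where
  field
    ε-closed  : N []
    ∙-closed  : ∀ {g h} → N g → N h → N (g ++ h)
    ⁻¹-closed : ∀ {g} → N g → N (invW g)
    conjugate : ∀ g {h} → N h → N (g ++ h ++ invW g)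

-- the quotient G / N (as a raw group: cosets gN = hN iff g⁻¹h ∈ N)
quotientRaw : ∀ {n} → (N : Word n → Set) → RawGroup 0ℓ 0ℓ
quotientRaw {n} N = record
  { Carrier = Word n
  ; _≈_     = λ g h → N (invW g ++ h)
  ; _∙_     = _++_
  ; ε       = []
  ; _⁻¹     = invW
  }

SD : ℕ → Set
SD n = V2 n × Sym n

_∙SD_ : ∀ {n} → SD n → SD n → SD n
(b , σ) ∙SD (b' , σ') = (b +V (Q σ *M b') , σ · σ')

εSD : ∀ {n} → SD n
εSD = (0V , idP)

invSD : ∀ {n} → SD n → SD n
invSD (b , σ) = (Q (invP σ) *M b , invP σ)

_≈SD_ : ∀ {n} → SD n → SD n → Set
(b , σ) ≈SD (b' , σ') = (b ≡ b') × (σ ≈P σ')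

SDRaw : ℕ → RawGroup 0ℓ 0ℓ
SDRaw n = record
  { Carrier = SD n
  ; _≈_     = _≈SD_
  ; _∙_     = _∙SD_
  ; ε       = εSD
  ; _⁻¹     = invSD
  }

actSD : ∀ {n} → SD n → 𝔻 n → 𝔻 n
actSD (b , σ) y = ς b (α'' σ y)

-- φ(s₁σ₁ ⋯ s_lσ_l) = ( Σᵢ Q(σ₁⋯σ_{i-1}) (sᵢ 𝟏) , σ₁ ⋯ σ_l )
-- φ-acc π w computes the sum with prefix products starting from π.

φ-acc : ∀ {n} → Sym n → Word n → SD n
φ-acc π []            = (0V , π)
φ-acc π ((s , σ) ∷ w) =
  let r = φ-acc (π · σ) w in ((Q π *M (s ·𝟏)) +V proj₁ r , proj₂ r)

φ : ∀ {n} → Word n → SD n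
φ = φ-acc idP

{-# OPTIONS --safe #-}
-- Let T be the linear involution of (ℤ/2ℤ)^{n+1} that exchanges e_{n+1} and 𝟏 and fixes the
-- other basis vectors.  Then Q(σ) = T P_σ T, where P_σ permutes coordinates, so Q is a
-- representation of Sym(n+1); and d^σ = 𝟏 + Q(σ)𝟏, so R(σ, v) = 𝟏 + Q(σ)(𝟏 + v) is Q
-- conjugated by a translation.  Hence α''_n and α_n × ς_n are actions and φ intertwines α * β
-- with α_n × ς_n.  The action α_n × ς_n is free (σ is read off the permutation component, then
-- b off the vector component), so g fixes x iff φ(g) = 1: G_x is the kernel of φ and acts
-- trivially on all of 𝔻_n, which gives normality, and φ is injective on G/G_x.  φ is onto
-- because conjugating the generator of ℤ/2ℤ by the transposition (k n+1) yields a translation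
-- by T e_k, and these vectors form a basis.
module Submission where

open import Defs
open import Algebra.Bundles using (CommutativeRing)
open import Algebra.Morphism.Structures using (module GroupMorphisms)
import Algebra.Properties.CommutativeSemigroup as CommutativeSemigroupProperties
open import Data.Bool using (Bool; true; false; not; _∧_; _xor_; if_then_else_)
open import Data.Bool.Properties
  using (xor-assoc; xor-comm; xor-same; xor-identityˡ; xor-identityʳ; xor-∧-commutativeRing;
         ∧-distribʳ-xor; ∧-assoc; ∧-comm; ∧-zeroʳ; ∧-identityʳ; not-involutive)
open import Data.Fin using (Fin; zero; suc; _≟_)
open import Data.Fin.Permutation as Perm using (Permutation′; _⟨$⟩ʳ_; _⟨$⟩ˡ_; inverseˡ; inverseʳ)
import Data.Fin.Permutation.Components as PC
open import Data.List using ([]; _∷_; _++_)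
open import Data.Nat using (ℕ; zero; suc; _≤_)
open import Data.Product using (Σ; Σ-syntax; _×_; _,_; proj₁; proj₂)
open import Data.Vec using (Vec; lookup; tabulate)
open import Data.Vec.Properties
  using (lookup∘tabulate; tabulate∘lookup; tabulate-cong; lookup-zipWith; lookup-replicate;
         zipWith-assoc; zipWith-identityˡ; zipWith-comm)
open import Function using (_∘_; mk⇔)
open import Level using (0ℓ)
open import Relation.Binary.Bundles using (Setoid)
open import Relation.Binary.PropositionalEquality
import Relation.Binary.Reasoning.Setoid as SetoidReasoning
open import Relation.Nullary using (yes; no)
open import Relation.Nullary.Decidable using (dec-true; dec-false; does-⇔)

private
  variable
    m n : ℕ

-- ℤ/2ℤ, the Kronecker delta and sums

private
  module Xor = CommutativeSemigroupProperties
    (CommutativeRing.+-commutativeSemigroup xor-∧-commutativeRing)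

xor-cancelʳ : ∀ x y → (x xor y) xor y ≡ x
xor-cancelʳ x y = trans (xor-assoc x y y) (trans (cong (x xor_) (xor-same y)) (xor-identityʳ x))

xor-cancel-common : ∀ x y z → (x xor z) xor (y xor z) ≡ x xor y
xor-cancel-common x y z = begin
  (x xor z) xor (y xor z)  ≡⟨ Xor.interchange x z y z ⟩
  (x xor y) xor (z xor z)  ≡⟨ cong ((x xor y) xor_) (xor-same z) ⟩
  (x xor y) xor false      ≡⟨ xor-identityʳ (x xor y) ⟩
  x xor y                  ∎
  where open ≡-Reasoning

δ-refl : (a : Fin m) → δ a a ≡ true
δ-refl a = dec-true (a ≟ a) refl

δ-≢ : {a b : Fin m} → a ≢ b → δ a b ≡ false
δ-≢ {a = a} {b} = dec-false (a ≟ b)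

δ-sym : (a b : Fin m) → δ a b ≡ δ b a
δ-sym a b = does-⇔ (mk⇔ sym sym) (a ≟ b) (b ≟ a)

⟨$⟩ʳ-injective : (σ : Permutation′ m) {a b : Fin m} → σ ⟨$⟩ʳ a ≡ σ ⟨$⟩ʳ b → a ≡ b
⟨$⟩ʳ-injective σ {a} {b} eq = begin
  a                      ≡⟨ inverseˡ σ ⟨
  σ ⟨$⟩ˡ (σ ⟨$⟩ʳ a)      ≡⟨ cong (σ ⟨$⟩ˡ_) eq ⟩
  σ ⟨$⟩ˡ (σ ⟨$⟩ʳ b)      ≡⟨ inverseˡ σ ⟩
  b                      ∎
  where open ≡-Reasoning

δ-permute : (σ : Permutation′ m) (a b : Fin m) → δ (σ ⟨$⟩ʳ a) (σ ⟨$⟩ʳ b) ≡ δ a b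
δ-permute σ a b = does-⇔ (mk⇔ (⟨$⟩ʳ-injective σ) (cong (σ ⟨$⟩ʳ_))) (_ ≟ _) (a ≟ b)

transpose-matchˡ : (i j : Fin m) → PC.transpose i j i ≡ j
transpose-matchˡ i j rewrite δ-refl i = refl

invP-inverseˡ : (σ : Sym n) → (invP σ · σ) ≈P idP
invP-inverseˡ σ i = inverseʳ σ

invP-inverseʳ : (σ : Sym n) → (σ · invP σ) ≈P idP
invP-inverseʳ σ i = inverseˡ σ

Σ₂-cong : {f g : Fin m → Z2} → (∀ j → f j ≡ g j) → Σ₂ f ≡ Σ₂ g
Σ₂-cong {zero}  f≗g = refl
Σ₂-cong {suc m} f≗g = cong₂ _xor_ (f≗g zero) (Σ₂-cong (f≗g ∘ suc))

Σ₂-xor : (f g : Fin m → Z2) → Σ₂ (λ j → f j xor g j) ≡ Σ₂ f xor Σ₂ g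
Σ₂-xor {zero}  f g = refl
Σ₂-xor {suc m} f g = trans (cong ((f zero xor g zero) xor_) (Σ₂-xor (f ∘ suc) (g ∘ suc)))
                           (Xor.interchange (f zero) (g zero) _ _)

Σ₂-false : Σ₂ {m} (λ _ → false) ≡ false
Σ₂-false {zero}  = refl
Σ₂-false {suc m} = Σ₂-false {m}

Σ₂-∧ˡ : (c : Z2) (f : Fin m → Z2) → Σ₂ (λ j → c ∧ f j) ≡ c ∧ Σ₂ f
Σ₂-∧ˡ true  f = refl
Σ₂-∧ˡ {m} false f = Σ₂-false {m}

Σ₂-δ : (a : Fin m) (f : Fin m → Z2) → Σ₂ (λ j → δ a j ∧ f j) ≡ f a
Σ₂-δ {suc m} zero    f = trans (cong (f zero xor_) (Σ₂-false {m})) (xor-identityʳ (f zero))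
Σ₂-δ {suc m} (suc a) f = Σ₂-δ a (f ∘ suc)

Σ₂-row : (a b : Fin m) (c : Z2) (f : Fin m → Z2) →
         Σ₂ (λ j → (δ a j xor (δ b j ∧ c)) ∧ f j) ≡ f a xor (c ∧ f b)
Σ₂-row a b c f = begin
  Σ₂ (λ j → (δ a j xor (δ b j ∧ c)) ∧ f j)
    ≡⟨ Σ₂-cong (λ j → expand (δ a j) (δ b j) (f j)) ⟩
  Σ₂ (λ j → (δ a j ∧ f j) xor (c ∧ (δ b j ∧ f j)))
    ≡⟨ Σ₂-xor (λ j → δ a j ∧ f j) (λ j → c ∧ (δ b j ∧ f j)) ⟩
  Σ₂ (λ j → δ a j ∧ f j) xor Σ₂ (λ j → c ∧ (δ b j ∧ f j))
    ≡⟨ cong₂ _xor_ (Σ₂-δ a f) (trans (Σ₂-∧ˡ c (λ j → δ b j ∧ f j)) (cong (c ∧_) (Σ₂-δ b f))) ⟩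
  f a xor (c ∧ f b) ∎
  where
  open ≡-Reasoning
  expand : ∀ x y w → (x xor (y ∧ c)) ∧ w ≡ (x ∧ w) xor (c ∧ (y ∧ w))
  expand x y w = begin
    (x xor (y ∧ c)) ∧ w          ≡⟨ ∧-distribʳ-xor w x (y ∧ c) ⟩
    (x ∧ w) xor ((y ∧ c) ∧ w)    ≡⟨ cong (λ u → (x ∧ w) xor (u ∧ w)) (∧-comm y c) ⟩
    (x ∧ w) xor ((c ∧ y) ∧ w)    ≡⟨ cong ((x ∧ w) xor_) (∧-assoc c y w) ⟩
    (x ∧ w) xor (c ∧ (y ∧ w))    ∎

-- Vectors over ℤ/2ℤ

lookup-ext : {A : Set} {u w : Vec A m} → (∀ i → lookup u i ≡ lookup w i) → u ≡ w
lookup-ext {u = u} {w} u≗w = begin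
  u                   ≡⟨ tabulate∘lookup u ⟨
  tabulate (lookup u) ≡⟨ tabulate-cong u≗w ⟩
  tabulate (lookup w) ≡⟨ tabulate∘lookup w ⟩
  w                   ∎
  where open ≡-Reasoning

𝟏 : V2 n
𝟏 = true ·𝟏

lookup-+V : (u w : V2 n) (i : Fin (suc n)) → lookup (u +V w) i ≡ lookup u i xor lookup w i
lookup-+V u w i = lookup-zipWith _xor_ i u w

+V-assoc : (u v w : V2 n) → (u +V v) +V w ≡ u +V (v +V w)
+V-assoc = zipWith-assoc xor-assoc

+V-comm : (u w : V2 n) → u +V w ≡ w +V u
+V-comm = zipWith-comm xor-comm

+V-identityˡ : (v : V2 n) → 0V +V v ≡ v
+V-identityˡ = zipWith-identityˡ xor-identityˡ

+V-self : (v : V2 n) → v +V v ≡ 0V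
+V-self v = lookup-ext λ i →
  trans (lookup-+V v v i) (trans (xor-same (lookup v i)) (sym (lookup-replicate i false)))

+V-cancelˡ : (u w : V2 n) → u +V (u +V w) ≡ w
+V-cancelˡ u w = begin
  u +V (u +V w)  ≡⟨ +V-assoc u u w ⟨
  (u +V u) +V w  ≡⟨ cong (_+V w) (+V-self u) ⟩
  0V +V w        ≡⟨ +V-identityˡ w ⟩
  w              ∎
  where open ≡-Reasoning

+V-cancelʳ : (u v w : V2 n) → u +V w ≡ v +V w → u ≡ v
+V-cancelʳ u v w eq = begin
  u               ≡⟨ +V-cancelˡ w u ⟨
  w +V (w +V u)   ≡⟨ cong (w +V_) (trans (+V-comm w u) (trans eq (+V-comm v w))) ⟩
  w +V (w +V v)   ≡⟨ +V-cancelˡ w v ⟩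
  v               ∎
  where open ≡-Reasoning

+V-swap : (u v w : V2 n) → u +V (v +V w) ≡ v +V (u +V w)
+V-swap u v w = begin
  u +V (v +V w)  ≡⟨ +V-assoc u v w ⟨
  (u +V v) +V w  ≡⟨ cong (_+V w) (+V-comm u v) ⟩
  (v +V u) +V w  ≡⟨ +V-assoc v u w ⟩
  v +V (u +V w)  ∎
  where open ≡-Reasoning

-- P σ of the paper is permute σ at A = ℕ*, definitionally.
permute : {A : Set} → Sym n → Vec A (suc n) → Vec A (suc n)
permute σ v = tabulate (λ i → lookup v (σ ⟨$⟩ʳ i))

lookup-permute : {A : Set} (σ : Sym n) (v : Vec A (suc n)) (i : Fin (suc n)) →
                 lookup (permute σ v) i ≡ lookup v (σ ⟨$⟩ʳ i)
lookup-permute σ v = lookup∘tabulate (λ i → lookup v (σ ⟨$⟩ʳ i))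

permute-∙ : {A : Set} (σ ρ : Sym n) (v : Vec A (suc n)) →
            permute (σ · ρ) v ≡ permute σ (permute ρ v)
permute-∙ σ ρ v = tabulate-cong (λ i → sym (lookup-permute ρ v (σ ⟨$⟩ʳ i)))

permute-id : {A : Set} (v : Vec A (suc n)) → permute idP v ≡ v
permute-id = tabulate∘lookup

permute-cong : {A : Set} {σ ρ : Sym n} → σ ≈P ρ → (v : Vec A (suc n)) →
               permute σ v ≡ permute ρ v
permute-cong σ≈ρ v = tabulate-cong (λ i → cong (lookup v) (σ≈ρ i))

permute-+V : (σ : Sym n) (u w : V2 n) → permute σ (u +V w) ≡ permute σ u +V permute σ w
permute-+V σ u w = lookup-ext λ i → begin
  lookup (permute σ (u +V w)) i
    ≡⟨ lookup-permute σ (u +V w) i ⟩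
  lookup (u +V w) (σ ⟨$⟩ʳ i)
    ≡⟨ lookup-+V u w (σ ⟨$⟩ʳ i) ⟩
  lookup u (σ ⟨$⟩ʳ i) xor lookup w (σ ⟨$⟩ʳ i)
    ≡⟨ cong₂ _xor_ (lookup-permute σ u i) (lookup-permute σ w i) ⟨
  lookup (permute σ u) i xor lookup (permute σ w) i
    ≡⟨ lookup-+V (permute σ u) (permute σ w) i ⟨
  lookup (permute σ u +V permute σ w) i ∎
  where open ≡-Reasoning

-- Q and R through the twist

-- Exchanges e_{n+1} and 𝟏 and fixes e_k for k ≤ n.
twist : V2 n → V2 n
twist {n} v = tabulate (λ k → lookup v k xor (not (δ k (top n)) ∧ lookup v (top n)))

lookup-twist : (v : V2 n) (k : Fin (suc n)) →
               lookup (twist v) k ≡ lookup v k xor (not (δ k (top n)) ∧ lookup v (top n))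
lookup-twist {n} v = lookup∘tabulate (λ k → lookup v k xor (not (δ k (top n)) ∧ lookup v (top n)))

lookup-twist-top : (v : V2 n) → lookup (twist v) (top n) ≡ lookup v (top n)
lookup-twist-top {n} v = begin
  lookup (twist v) (top n)
    ≡⟨ lookup-twist v (top n) ⟩
  lookup v (top n) xor (not (δ (top n) (top n)) ∧ lookup v (top n))
    ≡⟨ cong (λ b → lookup v (top n) xor (not b ∧ lookup v (top n))) (δ-refl (top n)) ⟩
  lookup v (top n) xor false
    ≡⟨ xor-identityʳ (lookup v (top n)) ⟩
  lookup v (top n) ∎
  where open ≡-Reasoning

lookup-twist-≢top : (v : V2 n) {k : Fin (suc n)} → k ≢ top n →
                    lookup (twist v) k ≡ lookup v k xor lookup v (top n)
lookup-twist-≢top {n} v {k} k≢top = begin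
  lookup (twist v) k
    ≡⟨ lookup-twist v k ⟩
  lookup v k xor (not (δ k (top n)) ∧ lookup v (top n))
    ≡⟨ cong (λ b → lookup v k xor (not b ∧ lookup v (top n))) (δ-≢ k≢top) ⟩
  lookup v k xor lookup v (top n) ∎
  where open ≡-Reasoning

twist-involutive : (v : V2 n) → twist (twist v) ≡ v
twist-involutive {n} v = lookup-ext lookup-twist²
  where
  lookup-twist² : ∀ k → lookup (twist (twist v)) k ≡ lookup v k
  lookup-twist² k with k ≟ top n
  ... | yes refl = trans (lookup-twist-top (twist v)) (lookup-twist-top v)
  ... | no k≢top = begin
    lookup (twist (twist v)) k
      ≡⟨ lookup-twist-≢top (twist v) k≢top ⟩
    lookup (twist v) k xor lookup (twist v) (top n)
      ≡⟨ cong₂ _xor_ (lookup-twist-≢top v k≢top) (lookup-twist-top v) ⟩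
    (lookup v k xor lookup v (top n)) xor lookup v (top n)
      ≡⟨ xor-cancelʳ (lookup v k) (lookup v (top n)) ⟩
    lookup v k ∎
    where open ≡-Reasoning

twist-+V : (u w : V2 n) → twist (u +V w) ≡ twist u +V twist w
twist-+V {n} u w = lookup-ext lookup-twist-+V
  where
  open ≡-Reasoning
  top-+V = lookup-+V u w (top n)
  lookup-twist-+V : ∀ k → lookup (twist (u +V w)) k ≡ lookup (twist u +V twist w) k
  lookup-twist-+V k with k ≟ top n
  ... | yes refl = begin
    lookup (twist (u +V w)) (top n)
      ≡⟨ trans (lookup-twist-top (u +V w)) top-+V ⟩
    lookup u (top n) xor lookup w (top n)
      ≡⟨ cong₂ _xor_ (lookup-twist-top u) (lookup-twist-top w) ⟨
    lookup (twist u) (top n) xor lookup (twist w) (top n)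
      ≡⟨ lookup-+V (twist u) (twist w) (top n) ⟨
    lookup (twist u +V twist w) (top n) ∎
  ... | no k≢top = begin
    lookup (twist (u +V w)) k
      ≡⟨ lookup-twist-≢top (u +V w) k≢top ⟩
    lookup (u +V w) k xor lookup (u +V w) (top n)
      ≡⟨ cong₂ _xor_ (lookup-+V u w k) top-+V ⟩
    (lookup u k xor lookup w k) xor (lookup u (top n) xor lookup w (top n))
      ≡⟨ Xor.interchange (lookup u k) (lookup w k) (lookup u (top n)) (lookup w (top n)) ⟩
    (lookup u k xor lookup u (top n)) xor (lookup w k xor lookup w (top n))
      ≡⟨ cong₂ _xor_ (lookup-twist-≢top u k≢top) (lookup-twist-≢top w k≢top) ⟨
    lookup (twist u) k xor lookup (twist w) k
      ≡⟨ lookup-+V (twist u) (twist w) k ⟨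
    lookup (twist u +V twist w) k ∎

Q-row : V2 n → Fin (suc n) → Fin (suc n) → Z2
Q-row {n} v a t =
  lookup v (PC.transpose (top n) t a) xor ((not (δ (top n) a) ∧ not (δ t (top n))) ∧ lookup v t)

twisted-row : V2 n → Fin (suc n) → Fin (suc n) → Z2
twisted-row v a t = lookup (twist v) a xor (not (δ a t) ∧ lookup (twist v) t)

lookup-Q*M : (σ : Sym n) (v : V2 n) (i : Fin (suc n)) →
             lookup (Q σ *M v) i ≡ Q-row v (σ ⟨$⟩ʳ i) (σ ⟨$⟩ʳ top n)
lookup-Q*M {n} σ v i = trans (lookup∘tabulate (λ i → Σ₂ (λ j → Q σ i j ∧ lookup v j)) i)
  (Σ₂-row (PC.transpose (top n) t a) t (not (δ (top n) a) ∧ not (δ t (top n))) (lookup v))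
  where
  a = σ ⟨$⟩ʳ i
  t = σ ⟨$⟩ʳ top n

Q-row≡twisted-row : (v : V2 n) (a t : Fin (suc n)) → Q-row v a t ≡ twisted-row v a t
Q-row≡twisted-row {n} v a t with a ≟ top n | t ≟ top n
... | yes refl | yes refl rewrite δ-refl (top n) | lookup-twist-top v = refl
... | yes refl | no t≢top
  rewrite δ-refl (top n) | δ-≢ (t≢top ∘ sym) | lookup-twist-top v | lookup-twist-≢top v t≢top
  = trans (xor-identityʳ (lookup v t))
          (sym (trans (xor-comm (lookup v (top n)) _)
                      (xor-cancelʳ (lookup v t) (lookup v (top n)))))
... | no a≢top | yes refl
  rewrite δ-≢ (a≢top ∘ sym) | δ-≢ a≢top | lookup-twist-≢top v a≢top | lookup-twist-top v
  = trans (xor-identityʳ (lookup v a)) (sym (xor-cancelʳ (lookup v a) (lookup v (top n))))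
... | no a≢top | no t≢top with a ≟ t
...   | yes refl rewrite δ-≢ (a≢top ∘ sym) | lookup-twist-≢top v a≢top
  = trans (xor-comm (lookup v (top n)) (lookup v a)) (sym (xor-identityʳ _))
...   | no a≢t rewrite δ-≢ (a≢top ∘ sym) | lookup-twist-≢top v a≢top | lookup-twist-≢top v t≢top
  = sym (xor-cancel-common (lookup v a) (lookup v t) (lookup v (top n)))

Q-twist : (σ : Sym n) (v : V2 n) → Q σ *M v ≡ twist (permute σ (twist v))
Q-twist {n} σ v = lookup-ext λ i → begin
  lookup (Q σ *M v) i
    ≡⟨ lookup-Q*M σ v i ⟩
  Q-row v (σ ⟨$⟩ʳ i) (σ ⟨$⟩ʳ top n)
    ≡⟨ Q-row≡twisted-row v (σ ⟨$⟩ʳ i) (σ ⟨$⟩ʳ top n) ⟩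
  twisted-row v (σ ⟨$⟩ʳ i) (σ ⟨$⟩ʳ top n)
    ≡⟨ cong₂ (λ x b → x xor (not b ∧ lookup (twist v) (σ ⟨$⟩ʳ top n)))
             (sym (lookup-permute σ (twist v) i)) (δ-permute σ i (top n)) ⟩
  lookup w i xor (not (δ i (top n)) ∧ lookup (twist v) (σ ⟨$⟩ʳ top n))
    ≡⟨ cong (λ x → lookup w i xor (not (δ i (top n)) ∧ x)) (lookup-permute σ (twist v) (top n)) ⟨
  lookup w i xor (not (δ i (top n)) ∧ lookup w (top n))
    ≡⟨ lookup-twist w i ⟨
  lookup (twist w) i ∎
  where
  open ≡-Reasoning
  w = permute σ (twist v)

Q-∙ : (σ ρ : Sym n) (v : V2 n) → Q (σ · ρ) *M v ≡ Q σ *M (Q ρ *M v)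
Q-∙ σ ρ v = begin
  Q (σ · ρ) *M v
    ≡⟨ Q-twist (σ · ρ) v ⟩
  twist (permute (σ · ρ) (twist v))
    ≡⟨ cong twist (permute-∙ σ ρ (twist v)) ⟩
  twist (permute σ (permute ρ (twist v)))
    ≡⟨ cong (twist ∘ permute σ) (twist-involutive (permute ρ (twist v))) ⟨
  twist (permute σ (twist (twist (permute ρ (twist v)))))
    ≡⟨ cong (twist ∘ permute σ ∘ twist) (Q-twist ρ v) ⟨
  twist (permute σ (twist (Q ρ *M v)))
    ≡⟨ Q-twist σ (Q ρ *M v) ⟨
  Q σ *M (Q ρ *M v) ∎
  where open ≡-Reasoning

Q-id : (v : V2 n) → Q idP *M v ≡ v
Q-id v = trans (Q-twist idP v) (trans (cong twist (permute-id (twist v))) (twist-involutive v))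

Q-cong : {σ ρ : Sym n} → σ ≈P ρ → (v : V2 n) → Q σ *M v ≡ Q ρ *M v
Q-cong {σ = σ} {ρ} σ≈ρ v =
  trans (Q-twist σ v)
        (trans (cong twist (permute-cong {σ = σ} {ρ} σ≈ρ (twist v))) (sym (Q-twist ρ v)))

Q-+V : (σ : Sym n) (u w : V2 n) → Q σ *M (u +V w) ≡ (Q σ *M u) +V (Q σ *M w)
Q-+V σ u w = begin
  Q σ *M (u +V w)
    ≡⟨ Q-twist σ (u +V w) ⟩
  twist (permute σ (twist (u +V w)))
    ≡⟨ cong (twist ∘ permute σ) (twist-+V u w) ⟩
  twist (permute σ (twist u +V twist w))
    ≡⟨ cong twist (permute-+V σ (twist u) (twist w)) ⟩
  twist (permute σ (twist u) +V permute σ (twist w))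
    ≡⟨ twist-+V (permute σ (twist u)) (permute σ (twist w)) ⟩
  twist (permute σ (twist u)) +V twist (permute σ (twist w))
    ≡⟨ cong₂ _+V_ (Q-twist σ u) (Q-twist σ w) ⟨
  (Q σ *M u) +V (Q σ *M w) ∎
  where open ≡-Reasoning

d-coboundary : (σ : Sym n) → d σ ≡ 𝟏 +V (Q σ *M 𝟏)
d-coboundary {n} σ = lookup-ext λ j →
  let a = σ ⟨$⟩ʳ j ; t = σ ⟨$⟩ʳ top n ; c = not (δ (top n) a) ∧ not (δ t (top n)) in sym (begin
  lookup (𝟏 +V (Q σ *M 𝟏)) j
    ≡⟨ lookup-+V 𝟏 (Q σ *M 𝟏) j ⟩
  lookup 𝟏 j xor lookup (Q σ *M 𝟏) j
    ≡⟨ cong₂ _xor_ (lookup-replicate j true) (lookup-Q*M σ 𝟏 j) ⟩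
  true xor (lookup 𝟏 (PC.transpose (top n) t a) xor (c ∧ lookup 𝟏 t))
    ≡⟨ cong₂ (λ x y → true xor (x xor (c ∧ y)))
             (lookup-replicate (PC.transpose (top n) t a) true) (lookup-replicate t true) ⟩
  not (not (c ∧ true))
    ≡⟨ trans (not-involutive (c ∧ true)) (∧-identityʳ c) ⟩
  not (δ (top n) a) ∧ not (δ t (top n))
    ≡⟨ cong (λ b → not (δ (top n) a) ∧ not b) (δ-sym t (top n)) ⟩
  not (δ (top n) a) ∧ not (δ (top n) t)
    ≡⟨ lookup∘tabulate (λ j → not (δ (top n) (σ ⟨$⟩ʳ j)) ∧ not (δ (top n) t)) j ⟨
  lookup (d σ) j ∎)
  where open ≡-Reasoning

R-shift : (σ : Sym n) (v : V2 n) → R σ v ≡ 𝟏 +V (Q σ *M (𝟏 +V v))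
R-shift σ v = begin
  d σ +V (Q σ *M v)                   ≡⟨ cong (_+V (Q σ *M v)) (d-coboundary σ) ⟩
  (𝟏 +V (Q σ *M 𝟏)) +V (Q σ *M v)     ≡⟨ +V-assoc 𝟏 (Q σ *M 𝟏) (Q σ *M v) ⟩
  𝟏 +V ((Q σ *M 𝟏) +V (Q σ *M v))     ≡⟨ cong (𝟏 +V_) (Q-+V σ 𝟏 v) ⟨
  𝟏 +V (Q σ *M (𝟏 +V v))              ∎
  where open ≡-Reasoning

R-∙ : (σ ρ : Sym n) (v : V2 n) → R (σ · ρ) v ≡ R σ (R ρ v)
R-∙ σ ρ v = begin
  R (σ · ρ) v
    ≡⟨ R-shift (σ · ρ) v ⟩
  𝟏 +V (Q (σ · ρ) *M (𝟏 +V v))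
    ≡⟨ cong (𝟏 +V_) (Q-∙ σ ρ (𝟏 +V v)) ⟩
  𝟏 +V (Q σ *M (Q ρ *M (𝟏 +V v)))
    ≡⟨ cong (λ w → 𝟏 +V (Q σ *M w)) (+V-cancelˡ 𝟏 (Q ρ *M (𝟏 +V v))) ⟨
  𝟏 +V (Q σ *M (𝟏 +V (𝟏 +V (Q ρ *M (𝟏 +V v)))))
    ≡⟨ cong (λ w → 𝟏 +V (Q σ *M (𝟏 +V w))) (R-shift ρ v) ⟨
  𝟏 +V (Q σ *M (𝟏 +V R ρ v))
    ≡⟨ R-shift σ (R ρ v) ⟨
  R σ (R ρ v) ∎
  where open ≡-Reasoning

R-id : (v : V2 n) → R idP v ≡ v
R-id v = trans (R-shift idP v) (trans (cong (𝟏 +V_) (Q-id (𝟏 +V v))) (+V-cancelˡ 𝟏 v))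

R-cong : {σ ρ : Sym n} → σ ≈P ρ → (v : V2 n) → R σ v ≡ R ρ v
R-cong {σ = σ} {ρ} σ≈ρ v =
  trans (R-shift σ v) (trans (cong (𝟏 +V_) (Q-cong {σ = σ} {ρ} σ≈ρ (𝟏 +V v))) (sym (R-shift ρ v)))

R-+V : (σ : Sym n) (b v : V2 n) → R σ (b +V v) ≡ (Q σ *M b) +V R σ v
R-+V σ b v = begin
  R σ (b +V v)                               ≡⟨ R-shift σ (b +V v) ⟩
  𝟏 +V (Q σ *M (𝟏 +V (b +V v)))              ≡⟨ cong (λ w → 𝟏 +V (Q σ *M w)) (+V-swap 𝟏 b v) ⟩
  𝟏 +V (Q σ *M (b +V (𝟏 +V v)))              ≡⟨ cong (𝟏 +V_) (Q-+V σ b (𝟏 +V v)) ⟩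
  𝟏 +V ((Q σ *M b) +V (Q σ *M (𝟏 +V v)))     ≡⟨ +V-swap 𝟏 (Q σ *M b) (Q σ *M (𝟏 +V v)) ⟩
  (Q σ *M b) +V (𝟏 +V (Q σ *M (𝟏 +V v)))     ≡⟨ cong ((Q σ *M b) +V_) (R-shift σ v) ⟨
  (Q σ *M b) +V R σ v                        ∎
  where open ≡-Reasoning

-- The actions on 𝔻_n

-- ≈𝔻 computes to a product, from which unification cannot recover the two points; the record
-- wrapper makes them inferable.
record _≋_ (y y' : 𝔻 n) : Set where
  constructor ≈𝔻⇒≋
  field ≋⇒≈𝔻 : y ≈𝔻 y'
open _≋_ public

infix 4 _≋_

≋-refl : {y : 𝔻 n} → y ≋ y
≋-refl = ≈𝔻⇒≋ ((λ _ → refl) , refl , refl , refl)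

≋-sym : {y y' : 𝔻 n} → y ≋ y' → y' ≋ y
≋-sym (≈𝔻⇒≋ (σ≈ , k≡ , v≡ , s≡)) = ≈𝔻⇒≋ ((λ i → sym (σ≈ i)) , sym k≡ , sym v≡ , sym s≡)

≋-trans : {y y' y'' : 𝔻 n} → y ≋ y' → y' ≋ y'' → y ≋ y''
≋-trans (≈𝔻⇒≋ (σ≈ , k≡ , v≡ , s≡)) (≈𝔻⇒≋ (σ≈' , k≡' , v≡' , s≡')) =
  ≈𝔻⇒≋ ((λ i → trans (σ≈ i) (σ≈' i)) , trans k≡ k≡' , trans v≡ v≡' , trans s≡ s≡')

≋-setoid : ℕ → Setoid 0ℓ 0ℓ
≋-setoid n = record
  { Carrier       = 𝔻 n
  ; _≈_           = _≋_
  ; isEquivalence = record { refl = ≋-refl ; sym = ≋-sym ; trans = ≋-trans }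
  }

module ≋-Reasoning {n : ℕ} = SetoidReasoning (≋-setoid n)

≡⇒≋ : {y y' : 𝔻 n} → y ≡ y' → y ≋ y'
≡⇒≋ refl = ≋-refl

α''-congˡ : {σ ρ : Sym n} → σ ≈P ρ → (y : 𝔻 n) → α'' σ y ≋ α'' ρ y
α''-congˡ {σ = σ} {ρ} σ≈ρ ⟨ σ' , k , v , s ⟩ =
  ≈𝔻⇒≋ ((λ i → cong (σ' ⟨$⟩ʳ_) (σ≈ρ i)) ,
        permute-cong {σ = σ} {ρ} σ≈ρ k , R-cong {σ = σ} {ρ} σ≈ρ v , refl)

α''-congʳ : (σ : Sym n) {y y' : 𝔻 n} → y ≋ y' → α'' σ y ≋ α'' σ y'
α''-congʳ σ {⟨ _ , _ , _ , _ ⟩} {⟨ _ , _ , _ , _ ⟩} (≈𝔻⇒≋ (σ'≈ρ' , k≡ , v≡ , s≡)) =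
  ≈𝔻⇒≋ ((λ i → σ'≈ρ' (σ ⟨$⟩ʳ i)) , cong (P σ) k≡ , cong (R σ) v≡ , s≡)

α''-∙ : (σ ρ : Sym n) (y : 𝔻 n) → α'' σ (α'' ρ y) ≋ α'' (σ · ρ) y
α''-∙ σ ρ ⟨ σ' , k , v , s ⟩ = ≈𝔻⇒≋ ((λ _ → refl) , sym (permute-∙ σ ρ k) , sym (R-∙ σ ρ v) , refl)

α''-id : (y : 𝔻 n) → α'' idP y ≋ y
α''-id ⟨ σ' , k , v , s ⟩ = ≈𝔻⇒≋ ((λ _ → refl) , permute-id k , R-id v , refl)

α''-inverseˡ : (σ : Sym n) (y : 𝔻 n) → α'' (invP σ) (α'' σ y) ≋ y
α''-inverseˡ σ y = begin
  α'' (invP σ) (α'' σ y)  ≈⟨ α''-∙ (invP σ) σ y ⟩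
  α'' (invP σ · σ) y      ≈⟨ α''-congˡ {σ = invP σ · σ} {idP} (invP-inverseˡ σ) y ⟩
  α'' idP y               ≈⟨ α''-id y ⟩
  y                       ∎
  where open ≋-Reasoning

α''-inverseʳ : (σ : Sym n) (y : 𝔻 n) → α'' σ (α'' (invP σ) y) ≋ y
α''-inverseʳ σ y = begin
  α'' σ (α'' (invP σ) y)  ≈⟨ α''-∙ σ (invP σ) y ⟩
  α'' (σ · invP σ) y      ≈⟨ α''-congˡ {σ = σ · invP σ} {idP} (invP-inverseʳ σ) y ⟩
  α'' idP y               ≈⟨ α''-id y ⟩
  y                       ∎
  where open ≋-Reasoning

ς-congʳ : (b : V2 n) {y y' : 𝔻 n} → y ≋ y' → ς b y ≋ ς b y'
ς-congʳ b {⟨ _ , _ , _ , _ ⟩} {⟨ _ , _ , _ , _ ⟩} (≈𝔻⇒≋ (σ≈ , k≡ , v≡ , s≡)) =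
  ≈𝔻⇒≋ (σ≈ , k≡ , cong (b +V_) v≡ , s≡)

β-cong : (s : Z2) {y y' : 𝔻 n} → y ≋ y' → β s y ≋ β s y'
β-cong s = ς-congʳ (s ·𝟏)

ς-+V : (a b : V2 n) (y : 𝔻 n) → ς a (ς b y) ≡ ς (a +V b) y
ς-+V a b ⟨ σ , k , v , s ⟩ = cong (λ w → ⟨ σ , k , w , s ⟩) (sym (+V-assoc a b v))

ς-0V : (y : 𝔻 n) → ς 0V y ≡ y
ς-0V ⟨ σ , k , v , s ⟩ = cong (λ w → ⟨ σ , k , w , s ⟩) (+V-identityˡ v)

β-involutive : (s : Z2) (y : 𝔻 n) → β s (β s y) ≡ y
β-involutive s y = begin
  ς (s ·𝟏) (ς (s ·𝟏) y)   ≡⟨ ς-+V (s ·𝟏) (s ·𝟏) y ⟩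
  ς ((s ·𝟏) +V (s ·𝟏)) y  ≡⟨ cong (λ b → ς b y) (+V-self (s ·𝟏)) ⟩
  ς 0V y                  ≡⟨ ς-0V y ⟩
  y                       ∎
  where open ≡-Reasoning

α''-ς : (σ : Sym n) (b : V2 n) (y : 𝔻 n) → α'' σ (ς b y) ≡ ς (Q σ *M b) (α'' σ y)
α''-ς σ b ⟨ σ' , k , v , s ⟩ = cong (λ w → ⟨ σ · σ' , P σ k , w , s ⟩) (R-+V σ b v)

act-++ : (g h : Word n) (y : 𝔻 n) → act (g ++ h) y ≡ act g (act h y)
act-++ []            h y = refl
act-++ ((s , σ) ∷ g) h y = cong (β s ∘ α'' σ) (act-++ g h y)

act-congʳ : (g : Word n) {y y' : 𝔻 n} → y ≋ y' → act g y ≋ act g y'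
act-congʳ []            y≋y' = y≋y'
act-congʳ ((s , σ) ∷ g) y≋y' = β-cong s (α''-congʳ σ (act-congʳ g y≋y'))

act-invW-letter : (s : Z2) (σ : Sym n) (y : 𝔻 n) →
                  act (invW ((s , σ) ∷ [])) y ≋ α'' (invP σ) (β s y)
act-invW-letter s σ y = begin
  β false (α'' (invP σ) (β s (α'' idP y)))  ≡⟨ ς-0V _ ⟩
  α'' (invP σ) (β s (α'' idP y))            ≈⟨ α''-congʳ (invP σ) (β-cong s (α''-id y)) ⟩
  α'' (invP σ) (β s y)                      ∎
  where open ≋-Reasoning

act-invWˡ : (g : Word n) (y : 𝔻 n) → act (invW g) (act g y) ≋ y
act-invWˡ []            y = ≋-refl
act-invWˡ ((s , σ) ∷ g) y = begin
  act (invW g ++ invW ((s , σ) ∷ [])) (β s (α'' σ z))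
    ≡⟨ act-++ (invW g) (invW ((s , σ) ∷ [])) (β s (α'' σ z)) ⟩
  act (invW g) (act (invW ((s , σ) ∷ [])) (β s (α'' σ z)))
    ≈⟨ act-congʳ (invW g) (act-invW-letter s σ (β s (α'' σ z))) ⟩
  act (invW g) (α'' (invP σ) (β s (β s (α'' σ z))))
    ≡⟨ cong (act (invW g) ∘ α'' (invP σ)) (β-involutive s (α'' σ z)) ⟩
  act (invW g) (α'' (invP σ) (α'' σ z))
    ≈⟨ act-congʳ (invW g) (α''-inverseˡ σ z) ⟩
  act (invW g) z
    ≈⟨ act-invWˡ g y ⟩
  y ∎
  where
  open ≋-Reasoning
  z = act g y

act-invWʳ : (g : Word n) (y : 𝔻 n) → act g (act (invW g) y) ≋ y
act-invWʳ []            y = ≋-refl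
act-invWʳ ((s , σ) ∷ g) y = begin
  β s (α'' σ (act g (act (invW g ++ letter⁻¹) y)))
    ≡⟨ cong (β s ∘ α'' σ ∘ act g) (act-++ (invW g) letter⁻¹ y) ⟩
  β s (α'' σ (act g (act (invW g) (act letter⁻¹ y))))
    ≈⟨ β-cong s (α''-congʳ σ (act-invWʳ g (act letter⁻¹ y))) ⟩
  β s (α'' σ (act letter⁻¹ y))
    ≈⟨ β-cong s (α''-congʳ σ (act-invW-letter s σ y)) ⟩
  β s (α'' σ (α'' (invP σ) (β s y)))
    ≈⟨ β-cong s (α''-inverseʳ σ (β s y)) ⟩
  β s (β s y)
    ≡⟨ β-involutive s y ⟩
  y ∎
  where
  open ≋-Reasoning
  letter⁻¹ = invW ((s , σ) ∷ [])

actSD-∙ : (p q : SD n) (y : 𝔻 n) → actSD (p ∙SD q) y ≋ actSD p (actSD q y)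
actSD-∙ (b , σ) (b' , σ') y = begin
  ς (b +V (Q σ *M b')) (α'' (σ · σ') y)       ≈⟨ ς-congʳ (b +V (Q σ *M b')) (α''-∙ σ σ' y) ⟨
  ς (b +V (Q σ *M b')) (α'' σ (α'' σ' y))     ≡⟨ ς-+V b (Q σ *M b') (α'' σ (α'' σ' y)) ⟨
  ς b (ς (Q σ *M b') (α'' σ (α'' σ' y)))      ≡⟨ cong (ς b) (α''-ς σ b' (α'' σ' y)) ⟨
  ς b (α'' σ (ς b' (α'' σ' y)))               ∎
  where open ≋-Reasoning

actSD-ε : (y : 𝔻 n) → actSD εSD y ≋ y
actSD-ε y = ≋-trans (≡⇒≋ (ς-0V (α'' idP y))) (α''-id y)

actSD-congˡ : (p q : SD n) → p ≈SD q → (y : 𝔻 n) → actSD p y ≋ actSD q y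
actSD-congˡ (b , σ) (.b , ρ) (refl , σ≈ρ) y = ς-congʳ b (α''-congˡ {σ = σ} {ρ} σ≈ρ y)

actSD-φ-acc : (π : Sym n) (g : Word n) (y : 𝔻 n) → actSD (φ-acc π g) y ≋ α'' π (act g y)
actSD-φ-acc π []            y = ≡⇒≋ (ς-0V (α'' π y))
actSD-φ-acc π ((s , σ) ∷ g) y = begin
  ς (u +V proj₁ r) (α'' (proj₂ r) y)      ≡⟨ ς-+V u (proj₁ r) (α'' (proj₂ r) y) ⟨
  ς u (actSD r y)                         ≈⟨ ς-congʳ u (actSD-φ-acc (π · σ) g y) ⟩
  ς u (α'' (π · σ) (act g y))             ≈⟨ ς-congʳ u (α''-∙ π σ (act g y)) ⟨
  ς u (α'' π (α'' σ (act g y)))           ≡⟨ α''-ς π (s ·𝟏) (α'' σ (act g y)) ⟨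
  α'' π (β s (α'' σ (act g y)))           ∎
  where
  open ≋-Reasoning
  u = Q π *M (s ·𝟏)
  r = φ-acc (π · σ) g

actSD-φ : (g : Word n) (y : 𝔻 n) → actSD (φ g) y ≋ act g y
actSD-φ g y = ≋-trans (actSD-φ-acc idP g y) (α''-id (act g y))

actSD-free : (p q : SD n) (y : 𝔻 n) → actSD p y ≋ actSD q y → p ≈SD q
actSD-free (b , σ) (b' , ρ) ⟨ σ' , k , v , s ⟩ (≈𝔻⇒≋ (σσ'≈ρσ' , _ , v≡ , _)) = b≡b' , σ≈ρ
  where
  σ≈ρ : σ ≈P ρ
  σ≈ρ i = ⟨$⟩ʳ-injective σ' (σσ'≈ρσ' i)
  b≡b' : b ≡ b'
  b≡b' = +V-cancelʳ b b' (R σ v) (trans v≡ (cong (b' +V_) (sym (R-cong {σ = σ} {ρ} σ≈ρ v))))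

∙SD-inverseʳ : (p : SD n) → (p ∙SD invSD p) ≈SD εSD
∙SD-inverseʳ (b , σ) = b+b≡0 , invP-inverseʳ σ
  where
  open ≡-Reasoning
  b+b≡0 : b +V (Q σ *M (Q (invP σ) *M b)) ≡ 0V
  b+b≡0 = begin
    b +V (Q σ *M (Q (invP σ) *M b))
      ≡⟨ cong (b +V_) (Q-∙ σ (invP σ) b) ⟨
    b +V (Q (σ · invP σ) *M b)
      ≡⟨ cong (b +V_) (Q-cong {σ = σ · invP σ} {idP} (invP-inverseʳ σ) b) ⟩
    b +V (Q idP *M b)
      ≡⟨ cong (b +V_) (Q-id b) ⟩
    b +V b
      ≡⟨ +V-self b ⟩
    0V ∎

-- Translations realised by words

Σᵥ : (Fin m → V2 n) → V2 n
Σᵥ {zero}  c = 0V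
Σᵥ {suc m} c = c zero +V Σᵥ (c ∘ suc)

lookup-Σᵥ : (c : Fin m → V2 n) (i : Fin (suc n)) → lookup (Σᵥ c) i ≡ Σ₂ (λ k → lookup (c k) i)
lookup-Σᵥ {zero}  c i = lookup-replicate i false
lookup-Σᵥ {suc m} c i =
  trans (lookup-+V (c zero) (Σᵥ (c ∘ suc)) i)
        (cong (lookup (c zero) i xor_) (lookup-Σᵥ (c ∘ suc) i))

basis : Fin (suc n) → V2 n
basis k = tabulate (λ j → δ j k)

lookup-basis : (k j : Fin (suc n)) → lookup (basis k) j ≡ δ j k
lookup-basis k = lookup∘tabulate (λ j → δ j k)

twist-𝟏 : twist 𝟏 ≡ basis (top n)
twist-𝟏 {n} = lookup-ext λ j → begin
  lookup (twist 𝟏) j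
    ≡⟨ lookup-twist 𝟏 j ⟩
  lookup 𝟏 j xor (not (δ j (top n)) ∧ lookup 𝟏 (top n))
    ≡⟨ cong₂ (λ x y → x xor (not (δ j (top n)) ∧ y))
             (lookup-replicate j true) (lookup-replicate (top n) true) ⟩
  not (not (δ j (top n)) ∧ true)
    ≡⟨ cong not (∧-identityʳ _) ⟩
  not (not (δ j (top n)))
    ≡⟨ not-involutive _ ⟩
  δ j (top n)
    ≡⟨ lookup-basis (top n) j ⟨
  lookup (basis (top n)) j ∎
  where open ≡-Reasoning

permute-basis : (σ : Sym n) (k : Fin (suc n)) → permute σ (basis (σ ⟨$⟩ʳ k)) ≡ basis k
permute-basis σ k = lookup-ext λ j → begin
  lookup (permute σ (basis (σ ⟨$⟩ʳ k))) j   ≡⟨ lookup-permute σ (basis (σ ⟨$⟩ʳ k)) j ⟩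
  lookup (basis (σ ⟨$⟩ʳ k)) (σ ⟨$⟩ʳ j)      ≡⟨ lookup-basis (σ ⟨$⟩ʳ k) (σ ⟨$⟩ʳ j) ⟩
  δ (σ ⟨$⟩ʳ j) (σ ⟨$⟩ʳ k)                   ≡⟨ δ-permute σ j k ⟩
  δ j k                                     ≡⟨ lookup-basis k j ⟨
  lookup (basis k) j                        ∎
  where open ≡-Reasoning

Q-transpose-𝟏 : (k : Fin (suc n)) → Q (Perm.transpose k (top n)) *M 𝟏 ≡ twist (basis k)
Q-transpose-𝟏 {n} k = begin
  Q π *M 𝟏
    ≡⟨ Q-twist π 𝟏 ⟩
  twist (permute π (twist 𝟏))
    ≡⟨ cong (twist ∘ permute π) twist-𝟏 ⟩
  twist (permute π (basis (top n)))
    ≡⟨ cong (twist ∘ permute π ∘ basis) (transpose-matchˡ k (top n)) ⟨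
  twist (permute π (basis (π ⟨$⟩ʳ k)))
    ≡⟨ cong twist (permute-basis π k) ⟩
  twist (basis k) ∎
  where
  open ≡-Reasoning
  π = Perm.transpose k (top n)

twist-expansion : (v : V2 n) → v ≡ Σᵥ (λ k → if lookup (twist v) k then twist (basis k) else 0V)
twist-expansion {n} v = lookup-ext pointwise
  where
  open ≡-Reasoning
  c = twist v
  term = λ k → if lookup c k then twist (basis k) else 0V
  row : Fin (suc n) → Fin (suc n) → Bool
  row i k = δ i k xor (δ (top n) k ∧ not (δ i (top n)))

  lookup-term : ∀ i k b → lookup (if b then twist (basis k) else 0V) i ≡ row i k ∧ b
  lookup-term i k true = begin
    lookup (twist (basis k)) i
      ≡⟨ lookup-twist (basis k) i ⟩
    lookup (basis k) i xor (not (δ i (top n)) ∧ lookup (basis k) (top n))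
      ≡⟨ cong₂ (λ x y → x xor (not (δ i (top n)) ∧ y)) (lookup-basis k i) (lookup-basis k (top n)) ⟩
    δ i k xor (not (δ i (top n)) ∧ δ (top n) k)
      ≡⟨ cong (δ i k xor_) (∧-comm (not (δ i (top n))) _) ⟩
    row i k
      ≡⟨ ∧-identityʳ (row i k) ⟨
    row i k ∧ true ∎
  lookup-term i k false = trans (lookup-replicate i false) (sym (∧-zeroʳ (row i k)))

  pointwise : ∀ i → lookup v i ≡ lookup (Σᵥ term) i
  pointwise i = begin
    lookup v i
      ≡⟨ cong (λ u → lookup u i) (twist-involutive v) ⟨
    lookup (twist c) i
      ≡⟨ lookup-twist c i ⟩
    lookup c i xor (not (δ i (top n)) ∧ lookup c (top n))
      ≡⟨ Σ₂-row i (top n) (not (δ i (top n))) (lookup c) ⟨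
    Σ₂ (λ k → row i k ∧ lookup c k)
      ≡⟨ Σ₂-cong (λ k → lookup-term i k (lookup c k)) ⟨
    Σ₂ (λ k → lookup (term k) i)
      ≡⟨ lookup-Σᵥ term i ⟨
    lookup (Σᵥ term) i ∎

Translation : V2 n → Set
Translation {n} b = Σ[ w ∈ Word n ] (∀ y → act w y ≋ ς b y)

translation-0V : Translation {n} 0V
translation-0V = [] , λ y → ≡⇒≋ (sym (ς-0V y))

translation-+V : {a b : V2 n} → Translation a → Translation b → Translation (a +V b)
translation-+V {a = a} {b} (w , w≋a) (w' , w'≋b) = w ++ w' , λ y → begin
  act (w ++ w') y    ≡⟨ act-++ w w' y ⟩
  act w (act w' y)   ≈⟨ act-congʳ w (w'≋b y) ⟩
  act w (ς b y)      ≈⟨ w≋a (ς b y) ⟩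
  ς a (ς b y)        ≡⟨ ς-+V a b y ⟩
  ς (a +V b) y       ∎
  where open ≋-Reasoning

translation-Σᵥ : (c : Fin m → V2 n) → (∀ k → Translation (c k)) → Translation (Σᵥ c)
translation-Σᵥ {zero}  c t = translation-0V
translation-Σᵥ {suc m} c t = translation-+V (t zero) (translation-Σᵥ (c ∘ suc) (t ∘ suc))

translation-conjugate : (σ : Sym n) (s : Z2) → Translation (Q σ *M (s ·𝟏))
translation-conjugate σ s = (false , σ) ∷ (s , invP σ) ∷ [] , λ y → begin
  β false (α'' σ (β s (α'' (invP σ) y)))
    ≡⟨ ς-0V (α'' σ (β s (α'' (invP σ) y))) ⟩
  α'' σ (β s (α'' (invP σ) y))
    ≡⟨ α''-ς σ (s ·𝟏) (α'' (invP σ) y) ⟩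
  ς (Q σ *M (s ·𝟏)) (α'' σ (α'' (invP σ) y))
    ≈⟨ ς-congʳ (Q σ *M (s ·𝟏)) (α''-inverseʳ σ y) ⟩
  ς (Q σ *M (s ·𝟏)) y ∎
  where open ≋-Reasoning

translation : (b : V2 n) → Translation b
translation {n} b = subst Translation (sym (twist-expansion b)) (translation-Σᵥ _ term)
  where
  term : ∀ k → Translation (if lookup (twist b) k then twist (basis k) else 0V)
  term k with lookup (twist b) k
  ... | true  = subst Translation (Q-transpose-𝟏 k)
                      (translation-conjugate (Perm.transpose k (top n)) true)
  ... | false = translation-0V

-- The stabiliser

φ-≈⇒act-≋ : (g h : Word n) → φ g ≈SD φ h → (y : 𝔻 n) → act g y ≋ act h y
φ-≈⇒act-≋ g h φg≈φh y = begin
  act g y          ≈⟨ actSD-φ g y ⟨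
  actSD (φ g) y    ≈⟨ actSD-congˡ (φ g) (φ h) φg≈φh y ⟩
  actSD (φ h) y    ≈⟨ actSD-φ h y ⟩
  act h y          ∎
  where open ≋-Reasoning

act-≋⇒φ-≈ : (g h : Word n) (y : 𝔻 n) → act g y ≋ act h y → φ g ≈SD φ h
act-≋⇒φ-≈ g h y gy≋hy = actSD-free (φ g) (φ h) y (begin
  actSD (φ g) y    ≈⟨ actSD-φ g y ⟩
  act g y          ≈⟨ gy≋hy ⟩
  act h y          ≈⟨ actSD-φ h y ⟨
  actSD (φ h) y    ∎)
  where open ≋-Reasoning

module StabiliserQuotient {n : ℕ} (x : 𝔻 n) where
  open GroupMorphisms (quotientRaw (Stab x)) (SDRaw n)
  open ≋-Reasoning

  Stab⇒act-trivial : (h : Word n) → Stab x h → (y : 𝔻 n) → act h y ≋ y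
  Stab⇒act-trivial h hx≈x = φ-≈⇒act-≋ h [] (act-≋⇒φ-≈ h [] x (≈𝔻⇒≋ hx≈x))

  Stab-invW-++⇒≋ : (g h : Word n) → Stab x (invW g ++ h) → act g x ≋ act h x
  Stab-invW-++⇒≋ g h st = begin
    act g x                            ≈⟨ act-congʳ g (≈𝔻⇒≋ st) ⟨
    act g (act (invW g ++ h) x)        ≡⟨ cong (act g) (act-++ (invW g) h x) ⟩
    act g (act (invW g) (act h x))     ≈⟨ act-invWʳ g (act h x) ⟩
    act h x                            ∎

  ≋⇒Stab-invW-++ : (g h : Word n) → act g x ≋ act h x → Stab x (invW g ++ h)
  ≋⇒Stab-invW-++ g h gx≋hx = ≋⇒≈𝔻 (begin
    act (invW g ++ h) x                ≡⟨ act-++ (invW g) h x ⟩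
    act (invW g) (act h x)             ≈⟨ act-congʳ (invW g) gx≋hx ⟨
    act (invW g) (act g x)             ≈⟨ act-invWˡ g x ⟩
    x                                  ∎)

  Stab-isNormalSubgroup : IsNormalSubgroup (Stab x)
  Stab-isNormalSubgroup = record
    { ε-closed  = ≋⇒≈𝔻 (≋-refl {y = x})
    ; ∙-closed  = λ {g} {h} gx≈x hx≈x → ≋⇒≈𝔻 (begin
        act (g ++ h) x   ≡⟨ act-++ g h x ⟩
        act g (act h x)  ≈⟨ act-congʳ g (≈𝔻⇒≋ hx≈x) ⟩
        act g x          ≈⟨ ≈𝔻⇒≋ gx≈x ⟩
        x                ∎)
    ; ⁻¹-closed = λ {g} gx≈x → ≋⇒≈𝔻 (begin
        act (invW g) x          ≈⟨ act-congʳ (invW g) (≈𝔻⇒≋ gx≈x) ⟨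
        act (invW g) (act g x)  ≈⟨ act-invWˡ g x ⟩
        x                       ∎)
    ; conjugate = λ g {h} hx≈x → ≋⇒≈𝔻 (begin
        act (g ++ h ++ invW g) x
          ≡⟨ act-++ g (h ++ invW g) x ⟩
        act g (act (h ++ invW g) x)
          ≡⟨ cong (act g) (act-++ h (invW g) x) ⟩
        act g (act h (act (invW g) x))
          ≈⟨ act-congʳ g (Stab⇒act-trivial h hx≈x (act (invW g) x)) ⟩
        act g (act (invW g) x)
          ≈⟨ act-invWʳ g x ⟩
        x ∎)
    }

  φ-++ : (g h : Word n) → φ (g ++ h) ≈SD (φ g ∙SD φ h)
  φ-++ g h = actSD-free (φ (g ++ h)) (φ g ∙SD φ h) x (begin
    actSD (φ (g ++ h)) x               ≈⟨ actSD-φ (g ++ h) x ⟩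
    act (g ++ h) x                     ≡⟨ act-++ g h x ⟩
    act g (act h x)                    ≈⟨ act-congʳ g (actSD-φ h x) ⟨
    act g (actSD (φ h) x)              ≈⟨ actSD-φ g (actSD (φ h) x) ⟨
    actSD (φ g) (actSD (φ h) x)        ≈⟨ actSD-∙ (φ g) (φ h) x ⟨
    actSD (φ g ∙SD φ h) x              ∎)

  φ-invW : (g : Word n) → φ (invW g) ≈SD invSD (φ g)
  φ-invW g = actSD-free (φ (invW g)) (invSD p) x (begin
    actSD (φ (invW g)) x               ≈⟨ actSD-φ (invW g) x ⟩
    act (invW g) x                     ≈⟨ act-congʳ (invW g) p[p⁻¹x]≋x ⟨
    act (invW g) (actSD p z)           ≈⟨ act-congʳ (invW g) (actSD-φ g z) ⟩
    act (invW g) (act g z)             ≈⟨ act-invWˡ g z ⟩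
    z                                  ∎)
    where
    p = φ g
    z = actSD (invSD p) x
    p[p⁻¹x]≋x : actSD p z ≋ x
    p[p⁻¹x]≋x = begin
      actSD p z                ≈⟨ actSD-∙ p (invSD p) x ⟨
      actSD (p ∙SD invSD p) x  ≈⟨ actSD-congˡ (p ∙SD invSD p) εSD (∙SD-inverseʳ p) x ⟩
      actSD εSD x              ≈⟨ actSD-ε x ⟩
      x                        ∎

  φ-surjective : (q : SD n) → Σ (Word n) (λ w → ∀ {z} → Stab x (invW z ++ w) → φ z ≈SD q)
  φ-surjective (b , σ) = w , λ {z} st → actSD-free (φ z) (b , σ) x (begin
    actSD (φ z) x              ≈⟨ actSD-φ z x ⟩
    act z x                    ≈⟨ Stab-invW-++⇒≋ z w st ⟩
    act (t ++ σ-word) x        ≡⟨ act-++ t σ-word x ⟩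
    act t (β false (α'' σ x))  ≈⟨ t≋b (β false (α'' σ x)) ⟩
    ς b (β false (α'' σ x))    ≡⟨ cong (ς b) (ς-0V (α'' σ x)) ⟩
    ς b (α'' σ x)              ∎)
    where
    t = proj₁ (translation b)
    t≋b = proj₂ (translation b)
    σ-word = (false , σ) ∷ []
    w = t ++ σ-word

  φ-isGroupIsomorphism : IsGroupIsomorphism φ
  φ-isGroupIsomorphism = record
    { isGroupMonomorphism = record
      { isGroupHomomorphism = record
        { isMonoidHomomorphism = record
          { isMagmaHomomorphism = record
            { isRelHomomorphism = record
              { cong = λ {g} {h} st → act-≋⇒φ-≈ g h x (Stab-invW-++⇒≋ g h st) }
            ; homo = φ-++
            }
          ; ε-homo = refl , λ _ → refl
          }
        ; ⁻¹-homo = φ-invW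
        }
      ; injective = λ {g} {h} φg≈φh → ≋⇒Stab-invW-++ g h (φ-≈⇒act-≋ g h φg≈φh x)
      }
    ; surjective = φ-surjective
    }

mainTheorem11 : (n : ℕ) → 1 ≤ n → (x : 𝔻 n) →
    IsNormalSubgroup (Stab x)
    × GroupMorphisms.IsGroupIsomorphism (quotientRaw (Stab x)) (SDRaw n) φ
    × (∀ (g : Word n) → actSD (φ g) x ≈𝔻 act g x)
mainTheorem11 n _ x = Stab-isNormalSubgroup , φ-isGroupIsomorphism , λ g → ≋⇒≈𝔻 (actSD-φ g x)
  where open StabiliserQuotient x
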